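{- Let $G$ be a finite simple graph with no isolated vertices and let $t\in\mathbb{N}$. Then $\mu^{(t)}(\widetilde G) \cong \widetilde{\mu^{(t)}(G)}$; that is, the generalized Mycielskian of the quotient graph of $G$ is isomorphic to the quotient graph of the generalized Mycielskian of $G$.
   Context: For $t \in \mathbb{N}$ and a graph $G$ with $V(G)=\{v_1,\dots,v_n\}$, the generalized Mycielskian $\mu^{(t)}(G)$ has vertex set $\{u_i^s : 1\le i\le n,\ 0\le s\le t\} \cup \{w\}$, with $u_i^0$ identified with $v_i$. For each edge $v_iv_j$ of $G$ it has edges $u_i^0u_j^0$ and $u_i^su_j^{s+1}$, $u_j^su_i^{s+1}$ for $0 \le s < t$; also edges $u_i^t w$ for $1 \le i \le n$; no other edges. Two vertices are twins if they have the same open neighborhood. For a graph $H$, define $x \sim y$ if $x=y$ or $x,y$ are twins; this is an equivalence relation with classes $[x]$. The quotient graph $\widetilde H$ has the classes as vertices, with $[x]$ adjacent to $[z]$ iff $x$ is adjacent to $z$ in $H$. -}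

module Defs where

open import Data.Nat using (ℕ; zero; suc)
open import Data.Fin using (Fin; toℕ)
open import Data.Product using (Σ; ∃; _×_; _,_)
open import Data.Sum using (_⊎_; inj₁; inj₂)
open import Data.Unit using (⊤; tt)
open import Data.Empty using (⊥)
open import Data.Bool using (Bool; true; false; T)
open import Relation.Binary.PropositionalEquality using (_≡_)
open import Function.Bundles using (_⇔_)

record Graph : Set₁ where
  field
    V   : Set
    Adj : V → V → Set

record SimpleGraph (n : ℕ) : Set where
  field
    adj    : Fin n → Fin n → Bool
    sym    : ∀ i j → adj i j ≡ adj j i
    irrefl : ∀ i → adj i i ≡ false

toGraph : ∀ {n} → SimpleGraph n → Graph
toGraph {n} G = record { V = Fin n ; Adj = λ i j → T (SimpleGraph.adj G i j) }

NoIsolated : ∀ {n} → SimpleGraph n → Set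
NoIsolated {n} G = ∀ (i : Fin n) → ∃ λ (j : Fin n) → T (SimpleGraph.adj G i j)

-- Used to represent quotient graphs (vertices = equivalence classes),
-- since Agda (without cubical) has no quotient types.
record SGraph : Set₁ where
  field
    V   : Set
    _≈_ : V → V → Set
    Adj : V → V → Set

-- Generalized Mycielskian μ^(t)(H).
-- Vertex u_i^s  is  inj₁ (v_i , s)  with s ∈ {0..t};  w  is  inj₂ tt.
MycV : ℕ → Set → Set
MycV t V = (V × Fin (suc t)) ⊎ ⊤

MycAdj : (t : ℕ) (V : Set) → (V → V → Set) → MycV t V → MycV t V → Set
MycAdj t V A (inj₁ (i , s)) (inj₁ (j , s')) =
  ((toℕ s ≡ 0 × toℕ s' ≡ 0) ⊎ (suc (toℕ s) ≡ toℕ s' ⊎ suc (toℕ s') ≡ toℕ s)) × A i j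
MycAdj t V A (inj₁ (i , s)) (inj₂ _) = toℕ s ≡ t
MycAdj t V A (inj₂ _) (inj₁ (j , s')) = toℕ s' ≡ t
MycAdj t V A (inj₂ _) (inj₂ _) = ⊥

Myc : ℕ → Graph → Graph
Myc t H = record { V = MycV t (Graph.V H) ; Adj = MycAdj t (Graph.V H) (Graph.Adj H) }

MycEq : (t : ℕ) (V : Set) → (V → V → Set) → MycV t V → MycV t V → Set
MycEq t V E (inj₁ (i , s)) (inj₁ (j , s')) = E i j × s ≡ s'
MycEq t V E (inj₁ _) (inj₂ _) = ⊥
MycEq t V E (inj₂ _) (inj₁ _) = ⊥
MycEq t V E (inj₂ _) (inj₂ _) = ⊤

MycS : ℕ → SGraph → SGraph
MycS t H = record
  { V   = MycV t (SGraph.V H)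
  ; _≈_ = MycEq t (SGraph.V H) (SGraph._≈_ H)
  ; Adj = MycAdj t (SGraph.V H) (SGraph.Adj H) }

-- Twins: same open neighbourhood.  (x ∼ y iff x = y or twins; since every
-- vertex is its own twin, ∼ coincides with Twin.)
Twin : (H : Graph) → Graph.V H → Graph.V H → Set
Twin H x y = ∀ z → (Graph.Adj H x z ⇔ Graph.Adj H y z)

Quot : Graph → SGraph
Quot H = record { V = Graph.V H ; _≈_ = Twin H ; Adj = Graph.Adj H }

-- Isomorphism of setoid-graphs = isomorphism of the graphs on the classes:
-- maps well defined on classes, mutually inverse on classes,
-- preserving and reflecting adjacency.
record _≅_ (A B : SGraph) : Set where
  open SGraph A renaming (V to VA; _≈_ to _≈A_; Adj to AdjA)
  open SGraph B renaming (V to VB; _≈_ to _≈B_; Adj to AdjB)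
  field
    to      : VA → VB
    from    : VB → VA
    to-cong   : ∀ {x y} → x ≈A y → to x ≈B to y
    from-cong : ∀ {x y} → x ≈B y → from x ≈A from y
    from-to : ∀ x → from (to x) ≈A x
    to-from : ∀ y → to (from y) ≈B y
    adj     : ∀ x y → (AdjA x y ⇔ AdjB (to x) (to y))

{-# OPTIONS --safe #-}
-- The isomorphism is the identity on vertices; everything rests on showing that
-- twins of μ^(t)(G) are exactly the pairs u_i^s, u_j^s with v_i, v_j twins in G.
-- A twin pair must sit on a common level: if u_i^s is below the top it has a
-- neighbour u_k^(s+1) (v_k a neighbour of v_i), which pins the level of its twin
-- to s or s+2, and by symmetry the two levels coincide.  The apex w has no twin,
-- because a twin of w would be adjacent to u_i^t for its own index i.
module Submission where

open import Data.Nat using (ℕ; suc)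
open import Data.Nat.Properties using (suc-injective; _≟_)
open import Data.Fin using (Fin; toℕ; fromℕ; lower₁; inject₁; zero; suc)
open import Data.Fin.Properties using (toℕ-fromℕ; toℕ-lower₁; toℕ-inject₁; toℕ-injective)
open import Data.Product using (∃; _×_; _,_; proj₁; proj₂)
open import Data.Sum using (_⊎_; inj₁; inj₂)
open import Data.Unit using (tt)
open import Data.Empty using (⊥-elim)
open import Data.Bool using (T)
open import Relation.Nullary using (¬_; yes; no)
open import Relation.Binary.PropositionalEquality using (_≡_; _≢_; refl; sym; trans; cong; subst)
open import Function.Bundles using (mk⇔; Equivalence)
open import Function.Construct.Identity using (⇔-id)
open import Function.Construct.Symmetry using (⇔-sym)
open import Defs

Twin-sym : ∀ (H : Graph) {x y} → Twin H x y → Twin H y x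
Twin-sym H tw z = ⇔-sym (tw z)

Twin-refl : ∀ (H : Graph) x → Twin H x x
Twin-refl H x z = ⇔-id _

module _ (t : ℕ) where

  Level : Set
  Level = Fin (suc t)

  LevelAdj : Level → Level → Set
  LevelAdj s s' = (toℕ s ≡ 0 × toℕ s' ≡ 0) ⊎ (suc (toℕ s) ≡ toℕ s' ⊎ suc (toℕ s') ≡ toℕ s)

  lowerLevel : Level → Level
  lowerLevel zero    = zero
  lowerLevel (suc r) = inject₁ r

  levelAdj-lowerLevel : ∀ s → LevelAdj s (lowerLevel s)
  levelAdj-lowerLevel zero    = inj₁ (refl , refl)
  levelAdj-lowerLevel (suc r) = inj₂ (inj₂ (cong suc (toℕ-inject₁ r)))

  nextLevel : ∀ (s : Level) → t ≢ toℕ s → ∃ λ (r : Level) → toℕ r ≡ suc (toℕ s)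
  nextLevel s t≢s = suc (lower₁ s t≢s) , cong suc (toℕ-lower₁ s t≢s)

  levelAdj-suc : ∀ {s s' r : Level} → toℕ r ≡ suc (toℕ s) → LevelAdj s' r →
                 toℕ s' ≡ toℕ s ⊎ toℕ s' ≡ suc (suc (toℕ s))
  levelAdj-suc r≡s+1 (inj₁ (_ , r≡0)) with trans (sym r≡s+1) r≡0
  ... | ()
  levelAdj-suc r≡s+1 (inj₂ (inj₁ s'+1≡r)) = inj₁ (suc-injective (trans s'+1≡r r≡s+1))
  levelAdj-suc r≡s+1 (inj₂ (inj₂ r+1≡s')) = inj₂ (trans (sym r+1≡s') (cong suc r≡s+1))

module _ (H : Graph) (t : ℕ) where
  open Graph H using (V; Adj)

  μH : Graph
  μH = Myc t H

  twin-level : ∀ {i j s s' k} → Adj i k → Twin μH (inj₁ (i , s)) (inj₁ (j , s')) →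
               toℕ s' ≡ toℕ s ⊎ toℕ s' ≡ suc (suc (toℕ s))
  twin-level {s = s} {k = k} i~k tw with t ≟ toℕ s
  ... | yes t≡s = inj₁ (trans (Equivalence.to (tw (inj₂ tt)) (sym t≡s)) t≡s)
  ... | no t≢s  =
    let (r , r≡s+1) = nextLevel t s t≢s
    in  levelAdj-suc t r≡s+1
          (proj₁ (Equivalence.to (tw (inj₁ (k , r))) (inj₂ (inj₁ (sym r≡s+1)) , i~k)))

  twin-sameLevel : (∀ v → ∃ (Adj v)) →
                   ∀ {i j s s'} → Twin μH (inj₁ (i , s)) (inj₁ (j , s')) → s ≡ s'
  twin-sameLevel noIsolated {i} {j} tw
    with twin-level (proj₂ (noIsolated i)) tw
       | twin-level (proj₂ (noIsolated j)) (Twin-sym μH tw)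
  ... | inj₁ s'≡s | _            = toℕ-injective (sym s'≡s)
  ... | inj₂ _    | inj₁ s≡s'    = toℕ-injective s≡s'
  ... | inj₂ up   | inj₂ down    = ⊥-elim (m≢4+m (trans down (cong (λ m → suc (suc m)) up)))
    where
      m≢4+m : ∀ {m} → m ≢ suc (suc (suc (suc m)))
      m≢4+m ()

  apex-notTwin : (∀ v → ¬ Adj v v) → ∀ {i s} → ¬ Twin μH (inj₂ tt) (inj₁ (i , s))
  apex-notTwin irrefl {i} tw =
    irrefl i (proj₂ (Equivalence.to (tw (inj₁ (i , fromℕ t))) (toℕ-fromℕ t)))

  sameLevelTwin⇒twin : ∀ {i j s} → Twin μH (inj₁ (i , s)) (inj₁ (j , s)) → Twin H i j
  sameLevelTwin⇒twin {s = s} tw k =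
    mk⇔ (λ i~k → proj₂ (Equivalence.to   (tw u) (levelAdj-lowerLevel t s , i~k)))
        (λ j~k → proj₂ (Equivalence.from (tw u) (levelAdj-lowerLevel t s , j~k)))
    where u = inj₁ (k , lowerLevel t s)

  twin⇒levelTwin : (∀ v → ¬ Adj v v) → (∀ v → ∃ (Adj v)) →
                   ∀ {x y} → Twin μH x y → MycEq t V (Twin H) x y
  twin⇒levelTwin _ noIsolated {inj₁ _} {inj₁ _} tw with twin-sameLevel noIsolated tw
  ... | refl = sameLevelTwin⇒twin tw , refl
  twin⇒levelTwin irrefl _ {inj₁ _} {inj₂ tt} tw = apex-notTwin irrefl (Twin-sym μH tw)
  twin⇒levelTwin irrefl _ {inj₂ tt} {inj₁ _} tw = apex-notTwin irrefl tw
  twin⇒levelTwin _ _ {inj₂ tt} {inj₂ tt} _ = tt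

  levelTwin⇒twin : ∀ {x y} → MycEq t V (Twin H) x y → Twin μH x y
  levelTwin⇒twin {inj₁ _} {inj₁ _} (tw , refl) (inj₁ (k , _)) =
    mk⇔ (λ (l , i~k) → l , Equivalence.to (tw k) i~k) (λ (l , j~k) → l , Equivalence.from (tw k) j~k)
  levelTwin⇒twin {inj₁ _} {inj₁ _} (_ , refl) (inj₂ tt) = ⇔-id _
  levelTwin⇒twin {inj₂ tt} {inj₂ tt} _ _ = ⇔-id _

  levelTwin-refl : ∀ x → MycEq t V (Twin H) x x
  levelTwin-refl (inj₁ (i , _)) = Twin-refl H i , refl
  levelTwin-refl (inj₂ tt) = tt

lemma6 : ∀ {n} (G : SimpleGraph n) → NoIsolated G → (t : ℕ) →
    MycS t (Quot (toGraph G)) ≅ Quot (Myc t (toGraph G))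
lemma6 G noIsolated t = record
  { to        = λ x → x
  ; from      = λ x → x
  ; to-cong   = levelTwin⇒twin (toGraph G) t
  ; from-cong = twin⇒levelTwin (toGraph G) t irrefl noIsolated
  ; from-to   = levelTwin-refl (toGraph G) t
  ; to-from   = Twin-refl (Myc t (toGraph G))
  ; adj       = λ _ _ → ⇔-id _
  }
  where
    irrefl : ∀ i → ¬ T (SimpleGraph.adj G i i)
    irrefl i = subst T (SimpleGraph.irrefl G i)
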